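{- If $G$ is a distance hereditary graph, then all construction sequences for $G$ have the same number of vertices added as true twins.
   Context: A distance hereditary (DH) graph is a graph constructible from a single vertex by finitely many operations: (1) adding a pendant vertex to a vertex $v$ (new vertex $v'$ and edge $vv'$); (2a) adding a true twin of a non-isolated vertex $v$ (new vertex $v'$ adjacent to $v$ and exactly to the neighbors of $v$); (2b) adding a false twin of a non-isolated vertex $v$ (new vertex $v'$ adjacent exactly to the neighbors of $v$, not to $v$). A construction sequence for $G$ is a sequence of such operations starting from a single vertex and producing $G$ (up to isomorphism). -}

module Defs where

open import Data.Nat using (ℕ; zero; suc; _+_)
open import Data.Fin using (Fin; zero; suc)
open import Data.Fin.Properties using (_≟_)
open import Data.Unit using (⊤)
open import Data.Bool using (Bool; true; false; _∨_)
open import Data.Product using (∃; Σ; _×_; _,_)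
open import Relation.Nullary.Decidable using (⌊_⌋)
open import Relation.Binary.PropositionalEquality using (_≡_)
open import Function.Bundles using (_↔_; Inverse)

Graph : ℕ → Set
Graph n = Fin n → Fin n → Bool

_≅_ : ∀ {n m} → Graph n → Graph m → Set
_≅_ {n} {m} G H =
  Σ (Fin n ↔ Fin m) λ σ → ∀ i j → G i j ≡ H (Inverse.to σ i) (Inverse.to σ j)

K1 : Graph 1
K1 _ _ = false

data Op (n : ℕ) : Set where
  pendant   : Fin n → Op n
  trueTwin  : Fin n → Op n
  falseTwin : Fin n → Op n

newAdj : ∀ {n} → Graph n → Op n → Fin n → Bool
newAdj G (pendant v)   j = ⌊ j ≟ v ⌋
newAdj G (trueTwin v)  j = ⌊ j ≟ v ⌋ ∨ G v j
newAdj G (falseTwin v) j = G v j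

-- Apply an operation: the new vertex is 'zero', old vertex i becomes 'suc i'.
apply : ∀ {n} → Graph n → Op n → Graph (suc n)
apply G op zero    zero    = false
apply G op zero    (suc j) = newAdj G op j
apply G op (suc i) zero    = newAdj G op i
apply G op (suc i) (suc j) = G i j

NonIsolated : ∀ {n} → Graph n → Fin n → Set
NonIsolated G v = ∃ λ u → G v u ≡ true

Allowed : ∀ {n} → Graph n → Op n → Set
Allowed G (pendant v)   = ⊤
Allowed G (trueTwin v)  = NonIsolated G v
Allowed G (falseTwin v) = NonIsolated G v

data OpSeq : ℕ → Set where
  start : OpSeq 1
  _▷_   : ∀ {n} → OpSeq n → Op n → OpSeq (suc n)

build : ∀ {n} → OpSeq n → Graph n
build start    = K1
build (s ▷ op) = apply (build s) op

Valid : ∀ {n} → OpSeq n → Set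
Valid start    = ⊤
Valid (s ▷ op) = Valid s × Allowed (build s) op

ConstructionSequence : ∀ {n} → Graph n → Set
ConstructionSequence G = Σ ℕ λ k → Σ (OpSeq k) λ s → Valid s × (build s ≅ G)

trueTwinCount : ∀ {n} → OpSeq n → ℕ
trueTwinCount start              = 0
trueTwinCount (s ▷ pendant _)    = trueTwinCount s
trueTwinCount (s ▷ trueTwin _)   = suc (trueTwinCount s)
trueTwinCount (s ▷ falseTwin _)  = trueTwinCount s

csTrueTwins : ∀ {n} {G : Graph n} → ConstructionSequence G → ℕ
csTrueTwins (k , s , _) = trueTwinCount s

DistanceHereditary : ∀ {n} → Graph n → Set
DistanceHereditary G = ConstructionSequence G

-- Whether the last vertex of a construction sequence was added as a true twin can be read
-- off the graph alone: it is then a twin of an adjacent vertex and has a further neighbour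
-- (IsTrueTwin).  Every removable vertex x (pendant or twin) can be made the last vertex of
-- a construction with the same number of true twins: if x is a twin of the last vertex,
-- swap the two; otherwise x is last in a reordering of the shorter sequence by induction,
-- and re-adding the old last vertex and then x exchanges the two final steps, neither of
-- which changes its true-twin status.  For two constructions of the same graph, reorder
-- the first so that it ends with the last vertex of the second; the final steps then agree,
-- and induction on the number of vertices compares the rest.
module Submission where

open import Defs
open import Data.Nat using (ℕ; zero; suc; _+_)
open import Data.Nat.Properties using (+-commutativeSemigroup)
open import Algebra.Properties.CommutativeSemigroup +-commutativeSemigroup using (x∙yz≈y∙xz)
open import Data.Fin using (Fin; zero; suc; punchIn; punchOut)
open import Data.Fin.Properties
  using (_≟_; 0≢1+n; punchInᵢ≢i; punchIn-injective; punchIn-punchOut; any?; all?; suc-injective)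
open import Data.Fin.Permutation
  using ( Permutation; _⟨$⟩ʳ_; _⟨$⟩ˡ_; inverseˡ; inverseʳ; flip; _∘ₚ_; remove; insert; transpose
        ; punchIn-permute; insert-punchIn; ↔⇒≡)
import Data.Fin.Permutation.Components as Components
open import Data.Bool using (Bool; true; false; _∨_; if_then_else_)
open import Data.Bool.Properties using (∨-zeroʳ; ¬-not) renaming (_≟_ to _≟ᵇ_)
open import Data.Unit using (tt)
open import Data.Empty using (⊥; ⊥-elim)
open import Data.Product using (Σ; _×_; _,_; proj₁; proj₂)
open import Data.Sum using (_⊎_; inj₁; inj₂)
open import Relation.Nullary using (¬_; Dec; yes; no)
open import Relation.Nullary.Decidable using (⌊_⌋; ¬?; _×-dec_; _→-dec_; dec-true; dec-false; isYes≗does)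
open import Relation.Nullary.Reflects using (Reflects; ofʸ; ofⁿ)
open import Relation.Binary.PropositionalEquality
open import Function.Bundles using (_⇔_; mk⇔; Equivalence)
open import Function.Construct.Composition using (_⇔-∘_)
open import Function.Construct.Symmetry using (⇔-sym)

Undirected : ∀ {n} → Graph n → Set
Undirected G = ∀ i j → G i j ≡ G j i

Loopless : ∀ {n} → Graph n → Set
Loopless G = ∀ i → G i i ≡ false

NoIsolatedVertex : ∀ {n} → Graph n → Set
NoIsolatedVertex G = ∀ i → NonIsolated G i

Pendant : ∀ {n} → Graph n → Fin n → Fin n → Set
Pendant G x v = G x v ≡ true × (∀ z → G x z ≡ true → z ≡ v)

NoIsolatedEdge : ∀ {n} → Graph n → Set
NoIsolatedEdge G = ∀ a b → Pendant G a b → Pendant G b a → ⊥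

Twins : ∀ {n} → Graph n → Fin n → Fin n → Set
Twins G x v = ∀ z → z ≢ x → z ≢ v → G x z ≡ G v z

Removable : ∀ {n} → Graph n → Fin n → Set
Removable {n} G x = Σ (Fin n) λ v → x ≢ v × (Pendant G x v ⊎ Twins G x v)

-- The neighbour w ≠ p excludes a pendant vertex x whose neighbour p has no other
-- neighbour: such an x is a twin of p as well.
IsTrueTwin : ∀ {n} → Graph n → Fin n → Set
IsTrueTwin {n} G x =
  Σ (Fin n) λ p → x ≢ p × Twins G x p × G x p ≡ true × Σ (Fin n) λ w → w ≢ p × G x w ≡ true

true≢false : true ≢ false
true≢false ()

adjacent⇒≢ : ∀ {n} {G : Graph n} → Loopless G → ∀ {a b} → G a b ≡ true → a ≢ b
adjacent⇒≢ loopless {a} ab refl = true≢false (trans (sym ab) (loopless a))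

⌊≟⌋-refl : ∀ {n} (v : Fin n) → ⌊ v ≟ v ⌋ ≡ true
⌊≟⌋-refl v = trans (isYes≗does (v ≟ v)) (dec-true (v ≟ v) refl)

⌊≟⌋-≢ : ∀ {n} {j v : Fin n} → j ≢ v → ⌊ j ≟ v ⌋ ≡ false
⌊≟⌋-≢ {j = j} {v} j≢v = trans (isYes≗does (j ≟ v)) (dec-false (j ≟ v) j≢v)

twins-sym : ∀ {n} {G : Graph n} {x v} → Twins G x v → Twins G v x
twins-sym t z z≢v z≢x = sym (t z z≢x z≢v)

pendant⇒¬isTrueTwin : ∀ {n} {G : Graph n} {x v} → Pendant G x v → ¬ IsTrueTwin G x
pendant⇒¬isTrueTwin (_ , only-v) (p , _ , _ , xp , w , w≢p , xw) =
  w≢p (trans (only-v w xw) (sym (only-v p xp)))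

falseTwins⇒¬isTrueTwin : ∀ {n} {G : Graph n} {x v} → Undirected G → x ≢ v → Twins G x v →
  G x v ≡ false → ¬ IsTrueTwin G x
falseTwins⇒¬isTrueTwin {G = G} {x} {v} sym-G x≢v twins xv (p , x≢p , twins-p , xp , _) =
  true≢false (trans (sym xv-true) xv)
  where
  p≢v : p ≢ v
  p≢v refl = true≢false (trans (sym xp) xv)
  xv-true : G x v ≡ true
  xv-true = begin
    G x v ≡⟨ twins-p v (≢-sym x≢v) (≢-sym p≢v) ⟩
    G p v ≡⟨ sym-G p v ⟩
    G v p ≡⟨ sym (twins p (≢-sym x≢p) p≢v) ⟩
    G x p ≡⟨ xp ⟩
    true ∎
    where open ≡-Reasoning

data RemovalKind {n} (G : Graph n) (x : Fin n) : Set where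
  viaPendant   : ∀ {v} → Pendant G x v → RemovalKind G x
  viaTrueTwin  : ∀ {v} → x ≢ v → Twins G x v → G x v ≡ true →
                 ∀ w → w ≢ v → G x w ≡ true → RemovalKind G x
  viaFalseTwin : ∀ {v} → x ≢ v → Twins G x v → G x v ≡ false → RemovalKind G x

removalKind : ∀ {n} (G : Graph n) x → Removable G x → RemovalKind G x
removalKind G x (v , x≢v , inj₁ x-at-v) = viaPendant x-at-v
removalKind G x (v , x≢v , inj₂ twins) with G x v in xv
... | false = viaFalseTwin x≢v twins xv
... | true with any? (λ w → (G x w ≟ᵇ true) ×-dec ¬? (w ≟ v))
...   | yes (w , xw , w≢v) = viaTrueTwin x≢v twins xv w w≢v xw
...   | no no-other = viaPendant (xv , only-v)
  where
  only-v : ∀ z → G x z ≡ true → z ≡ v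
  only-v z xz with z ≟ v
  ... | yes z≡v = z≡v
  ... | no z≢v = ⊥-elim (no-other (z , xz , z≢v))

addsTrueTwin : ∀ {n} → Op n → Bool
addsTrueTwin (pendant _)   = false
addsTrueTwin (trueTwin _)  = true
addsTrueTwin (falseTwin _) = false

trueTwinBit : ∀ {n} → Op n → ℕ
trueTwinBit op = if addsTrueTwin op then 1 else 0

trueTwinCount-▷ : ∀ {n} (s : OpSeq n) op → trueTwinCount (s ▷ op) ≡ trueTwinBit op + trueTwinCount s
trueTwinCount-▷ s (pendant _)   = refl
trueTwinCount-▷ s (trueTwin _)  = refl
trueTwinCount-▷ s (falseTwin _) = refl

reflects-⇔ : ∀ {P Q : Set} {a b} → Reflects P a → Reflects Q b → P ⇔ Q → a ≡ b
reflects-⇔ (ofʸ _)  (ofʸ _)  _   = refl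
reflects-⇔ (ofʸ p)  (ofⁿ ¬q) P⇔Q = ⊥-elim (¬q (Equivalence.to P⇔Q p))
reflects-⇔ (ofⁿ ¬p) (ofʸ q)  P⇔Q = ⊥-elim (¬p (Equivalence.from P⇔Q q))
reflects-⇔ (ofⁿ _)  (ofⁿ _)  _   = refl

trueTwinBit-≡ : ∀ {n m} {P Q : Set} {a : Op n} {b : Op m} → Reflects P (addsTrueTwin a) →
  Reflects Q (addsTrueTwin b) → P ⇔ Q → trueTwinBit a ≡ trueTwinBit b
trueTwinBit-≡ P? Q? P⇔Q = cong (λ u → if u then 1 else 0) (reflects-⇔ P? Q? P⇔Q)

module _ {n} {H : Graph n} where
  apply-undirected : Undirected H → ∀ op → Undirected (apply H op)
  apply-undirected sym-H op zero    zero    = refl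
  apply-undirected sym-H op zero    (suc j) = refl
  apply-undirected sym-H op (suc i) zero    = refl
  apply-undirected sym-H op (suc i) (suc j) = sym-H i j

  apply-loopless : Loopless H → ∀ op → Loopless (apply H op)
  apply-loopless loopless-H op zero    = refl
  apply-loopless loopless-H op (suc i) = loopless-H i

  newVertex-nonIsolated : ∀ op → Allowed H op → NonIsolated (apply H op) zero
  newVertex-nonIsolated (pendant v)   _        = suc v , ⌊≟⌋-refl v
  newVertex-nonIsolated (trueTwin v)  (u , vu) = suc u , trans (cong (⌊ u ≟ v ⌋ ∨_) vu) (∨-zeroʳ _)
  newVertex-nonIsolated (falseTwin v) (u , vu) = suc u , vu

  pendant-newVertex : ∀ v → Pendant (apply H (pendant v)) zero (suc v)
  pendant-newVertex v = ⌊≟⌋-refl v , only-v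
    where
    only-v : ∀ z → apply H (pendant v) zero z ≡ true → z ≡ suc v
    only-v (suc j) jv with j ≟ v
    ... | yes refl = refl
    ... | no _     = ⊥-elim (true≢false (sym jv))

  twins-newVertex-trueTwin : ∀ v → Twins (apply H (trueTwin v)) zero (suc v)
  twins-newVertex-trueTwin v zero    z≢0 _      = ⊥-elim (z≢0 refl)
  twins-newVertex-trueTwin v (suc j) _   j≢v = cong (_∨ H v j) (⌊≟⌋-≢ (λ j≡v → j≢v (cong suc j≡v)))

  twins-newVertex-falseTwin : ∀ v → Twins (apply H (falseTwin v)) zero (suc v)
  twins-newVertex-falseTwin v zero    z≢0 _ = ⊥-elim (z≢0 refl)
  twins-newVertex-falseTwin v (suc j) _   _ = refl

  removable-newVertex : ∀ op → Removable (apply H op) zero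
  removable-newVertex (pendant v)   = suc v , 0≢1+n , inj₁ (pendant-newVertex v)
  removable-newVertex (trueTwin v)  = suc v , 0≢1+n , inj₂ (twins-newVertex-trueTwin v)
  removable-newVertex (falseTwin v) = suc v , 0≢1+n , inj₂ (twins-newVertex-falseTwin v)

  newVertex-reflects : Undirected H → Loopless H → ∀ op → Allowed H op →
    Reflects (IsTrueTwin (apply H op) zero) (addsTrueTwin op)
  newVertex-reflects _ _ (pendant v) _ = ofⁿ (pendant⇒¬isTrueTwin (pendant-newVertex v))
  newVertex-reflects _ loopless-H (trueTwin v) (u , vu) =
    ofʸ (suc v , 0≢1+n , twins-newVertex-trueTwin v , cong (_∨ H v v) (⌊≟⌋-refl v) ,
         suc u , u≢v , trans (cong (⌊ u ≟ v ⌋ ∨_) vu) (∨-zeroʳ _))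
    where
    u≢v : suc u ≢ suc v
    u≢v refl = true≢false (trans (sym vu) (loopless-H v))
  newVertex-reflects sym-H loopless-H (falseTwin v) _ =
    ofⁿ (falseTwins⇒¬isTrueTwin (apply-undirected sym-H (falseTwin v)) 0≢1+n
           (twins-newVertex-falseTwin v) (loopless-H v))

build-undirected : ∀ {n} (s : OpSeq n) → Undirected (build s)
build-undirected start    _ _ = refl
build-undirected (s ▷ op) = apply-undirected (build-undirected s) op

build-loopless : ∀ {n} (s : OpSeq n) → Loopless (build s)
build-loopless start    _ = refl
build-loopless (s ▷ op) = apply-loopless (build-loopless s) op

build-reflects : ∀ {n} (s : OpSeq n) op → Allowed (build s) op →
  Reflects (IsTrueTwin (build (s ▷ op)) zero) (addsTrueTwin op)
build-reflects s = newVertex-reflects (build-undirected s) (build-loopless s)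

build-noIsolatedVertex : ∀ {k} (s : OpSeq (suc (suc k))) → Valid s → NoIsolatedVertex (build s)
build-noIsolatedVertex (s ▷ op) (_ , allowed) zero = newVertex-nonIsolated op allowed
build-noIsolatedVertex {zero} (start ▷ pendant zero) _ (suc zero) = zero , refl
build-noIsolatedVertex {zero} (start ▷ trueTwin zero)  (_ , _ , ()) (suc zero)
build-noIsolatedVertex {zero} (start ▷ falseTwin zero) (_ , _ , ()) (suc zero)
build-noIsolatedVertex {suc k} (s ▷ op) (valid , _) (suc i) =
  let (j , ij) = build-noIsolatedVertex s valid i in suc j , ij

Fin2-cover : ∀ {a b : Fin 2} → a ≢ b → ∀ c → c ≡ a ⊎ c ≡ b
Fin2-cover {zero}     {zero}     a≢b _          = ⊥-elim (a≢b refl)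
Fin2-cover {zero}     {suc zero} _   zero       = inj₁ refl
Fin2-cover {zero}     {suc zero} _   (suc zero) = inj₂ refl
Fin2-cover {suc zero} {zero}     _   zero       = inj₂ refl
Fin2-cover {suc zero} {zero}     _   (suc zero) = inj₁ refl
Fin2-cover {suc zero} {suc zero} a≢b _          = ⊥-elim (a≢b refl)

build-noIsolatedEdge : ∀ {k} (s : OpSeq (suc (suc (suc k)))) → Valid s → NoIsolatedEdge (build s)
build-noIsolatedEdge (s ▷ op) _ zero zero (loop , _) _ = true≢false (sym loop)
build-noIsolatedEdge (s ▷ op) (valid , _) zero (suc b) _ (_ , only-0) =
  let (c , bc) = build-noIsolatedVertex s valid b in 0≢1+n (sym (only-0 (suc c) bc))
build-noIsolatedEdge (s ▷ op) (valid , _) (suc a) zero (_ , only-0) _ =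
  let (c , ac) = build-noIsolatedVertex s valid a in 0≢1+n (sym (only-0 (suc c) ac))
build-noIsolatedEdge {zero} (s ▷ op) valid (suc a) (suc b) (ab , only-b) (_ , only-a)
  with build-noIsolatedVertex (s ▷ op) valid zero
... | zero , ()
... | suc c , zc with Fin2-cover {a} {b} (adjacent⇒≢ (build-loopless s) ab) c
...   | inj₁ refl = 0≢1+n (only-b zero (trans (build-undirected (s ▷ op) (suc c) zero) zc))
...   | inj₂ refl = 0≢1+n (only-a zero (trans (build-undirected (s ▷ op) (suc c) zero) zc))
build-noIsolatedEdge {suc k} (s ▷ op) (valid , _) (suc a) (suc b) (ab , only-b) (ba , only-a) =
  build-noIsolatedEdge s valid a b
    (ab , λ z az → suc-injective (only-b (suc z) az)) (ba , λ z bz → suc-injective (only-a (suc z) bz))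

infix 4 _≅⟨_⟩_

record _≅⟨_⟩_ {n m} (G : Graph n) (π : Permutation n m) (H : Graph m) : Set where
  constructor isoBy
  field same-adjacency : ∀ i j → G i j ≡ H (π ⟨$⟩ʳ i) (π ⟨$⟩ʳ j)

open _≅⟨_⟩_

≅-trans : ∀ {n m k} {G : Graph n} {H : Graph m} {K : Graph k} {π ρ} →
  G ≅⟨ π ⟩ H → H ≅⟨ ρ ⟩ K → G ≅⟨ π ∘ₚ ρ ⟩ K
≅-trans G≅H H≅K = isoBy λ i j → trans (same-adjacency G≅H i j) (same-adjacency H≅K _ _)

module _ {n m} {G : Graph n} {H : Graph m} {π : Permutation n m} (G≅H : G ≅⟨ π ⟩ H) where
  private
    f = π ⟨$⟩ʳ_
    g = π ⟨$⟩ˡ_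

    f-≢ : ∀ {a b} → a ≢ b → f a ≢ f b
    f-≢ a≢b fa≡fb = a≢b (trans (sym (inverseˡ π)) (trans (cong g fa≡fb) (inverseˡ π)))

    g-≢ : ∀ {a b} → a ≢ f b → g a ≢ b
    g-≢ a≢fb ga≡b = a≢fb (trans (sym (inverseʳ π)) (cong f ga≡b))

    H-row : ∀ a z → H (f a) z ≡ G a (g z)
    H-row a z = trans (cong (H (f a)) (sym (inverseʳ π))) (sym (same-adjacency G≅H a (g z)))

  ≅-sym : H ≅⟨ flip π ⟩ G
  ≅-sym = isoBy λ i j → sym (trans (same-adjacency G≅H (g i) (g j)) (cong₂ H (inverseʳ π) (inverseʳ π)))

  twins-≅ : ∀ {x v} → Twins G x v → Twins H (f x) (f v)
  twins-≅ {x} {v} twins z z≢x z≢v =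
    trans (H-row x z) (trans (twins (g z) (g-≢ z≢x) (g-≢ z≢v)) (sym (H-row v z)))

  pendant-≅ : ∀ {x v} → Pendant G x v → Pendant H (f x) (f v)
  pendant-≅ {x} {v} (xv , only-v) =
    trans (sym (same-adjacency G≅H x v)) xv ,
    λ z xz → trans (sym (inverseʳ π)) (cong f (only-v (g z) (trans (sym (H-row x z)) xz)))

  isTrueTwin-≅ : ∀ {x} → IsTrueTwin G x → IsTrueTwin H (f x)
  isTrueTwin-≅ (p , x≢p , twins , xp , w , w≢p , xw) =
    f p , f-≢ x≢p , twins-≅ twins , trans (sym (same-adjacency G≅H _ _)) xp ,
    f w , f-≢ w≢p , trans (sym (same-adjacency G≅H _ _)) xw

  removable-≅ : ∀ {x} → Removable G x → Removable H (f x)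
  removable-≅ (v , x≢v , inj₁ x-at-v) = f v , f-≢ x≢v , inj₁ (pendant-≅ x-at-v)
  removable-≅ (v , x≢v , inj₂ twins)  = f v , f-≢ x≢v , inj₂ (twins-≅ twins)

isTrueTwin-≅-⇔ : ∀ {n m} {G : Graph n} {H : Graph m} {π : Permutation n m} → G ≅⟨ π ⟩ H →
  ∀ {x y} → π ⟨$⟩ʳ x ≡ y → IsTrueTwin G x ⇔ IsTrueTwin H y
isTrueTwin-≅-⇔ {G = G} {H} {π} G≅H {x} refl =
  mk⇔ (isTrueTwin-≅ G≅H) (λ t → subst (IsTrueTwin G) (inverseˡ π) (isTrueTwin-≅ (≅-sym G≅H) t))

transpose-cases : ∀ {n} (a b k : Fin n) →
  (k ≡ a × Components.transpose a b k ≡ b) ⊎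
  (k ≢ a × k ≡ b × Components.transpose a b k ≡ a) ⊎
  (k ≢ a × k ≢ b × Components.transpose a b k ≡ k)
transpose-cases a b k with k ≟ a
... | yes k≡a = inj₁ (k≡a , refl)
... | no k≢a with k ≟ b
...   | yes k≡b = inj₂ (inj₁ (k≢a , k≡b , refl))
...   | no k≢b  = inj₂ (inj₂ (k≢a , k≢b , refl))

swap-adjacency : ∀ {n} {G : Graph n} {a b} → Undirected G → Loopless G → Twins G a b →
  ∀ i j → G i j ≡ G (transpose a b ⟨$⟩ʳ i) (transpose a b ⟨$⟩ʳ j)
swap-adjacency {a = a} {b} sym-G loopless twins i j with transpose-cases a b i | transpose-cases a b j
... | inj₁ (refl , ei) | inj₁ (refl , ej) rewrite ei = trans (loopless _) (sym (loopless _))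
... | inj₁ (refl , ei) | inj₂ (inj₁ (_ , refl , ej)) rewrite ei | ej = sym-G _ _
... | inj₁ (refl , ei) | inj₂ (inj₂ (j≢a , j≢b , ej)) rewrite ei | ej = twins j j≢a j≢b
... | inj₂ (inj₁ (_ , refl , ei)) | inj₁ (refl , ej) rewrite ei | ej = sym-G _ _
... | inj₂ (inj₁ (_ , refl , ei)) | inj₂ (inj₁ (_ , refl , ej)) rewrite ei = trans (loopless _) (sym (loopless _))
... | inj₂ (inj₁ (_ , refl , ei)) | inj₂ (inj₂ (j≢a , j≢b , ej)) rewrite ei | ej = sym (twins j j≢a j≢b)
... | inj₂ (inj₂ (i≢a , i≢b , ei)) | inj₁ (refl , ej) rewrite ei | ej =
  trans (sym-G i a) (trans (twins i i≢a i≢b) (sym-G b i))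
... | inj₂ (inj₂ (i≢a , i≢b , ei)) | inj₂ (inj₁ (_ , refl , ej)) rewrite ei | ej =
  trans (sym-G i b) (trans (sym (twins i i≢a i≢b)) (sym-G a i))
... | inj₂ (inj₂ (i≢a , i≢b , ei)) | inj₂ (inj₂ (j≢a , j≢b , ej)) rewrite ei | ej = refl

twins⇒transpose-≅ : ∀ {n} {G : Graph n} {a b} → Undirected G → Loopless G → Twins G a b →
  G ≅⟨ transpose a b ⟩ G
twins⇒transpose-≅ sym-G loopless twins = isoBy (swap-adjacency sym-G loopless twins)

pendant-on-removable⇒twins : ∀ {n} {G : Graph n} {y z} → Undirected G → Removable G z → y ≢ z →
  Pendant G y z → Twins G y z
pendant-on-removable⇒twins {G = G} {y} {z} sym-G (q , z≢q , inj₁ (zq , only-q)) y≢z (yz , only-z) a a≢y a≢z =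
  trans (¬-not (λ ya → a≢z (only-z a ya))) (sym (¬-not (λ za → a≢y (trans (only-q a za) (sym y≡q)))))
  where
  y≡q : y ≡ q
  y≡q = only-q y (trans (sym-G z y) yz)
pendant-on-removable⇒twins {G = G} {y} {z} sym-G (q , z≢q , inj₂ twins) y≢z (yz , only-z) with q ≟ y
... | yes refl = twins-sym twins
... | no q≢y = ⊥-elim (z≢q (sym (only-z q yq)))
  where
  yq : G y q ≡ true
  yq = trans (sym-G y q) (trans (sym (twins y y≢z (≢-sym q≢y))) (trans (sym-G z y) yz))

partner-≢ : ∀ {n} {G : Graph n} {y z v} → Undirected G → Removable G z → y ≢ z → ¬ Twins G y z →
  (Pendant G y v ⊎ Twins G y v) → v ≢ z
partner-≢ sym-G z-removable y≢z ¬twins (inj₁ y-at-z) refl =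
  ¬twins (pendant-on-removable⇒twins sym-G z-removable y≢z y-at-z)
partner-≢ sym-G z-removable y≢z ¬twins (inj₂ twins) refl = ¬twins twins

punchIn-preimage : ∀ {n} (y a : Fin (suc n)) → y ≢ a → Σ (Fin n) λ a′ → punchIn y a′ ≡ a
punchIn-preimage y a y≢a = punchOut y≢a , punchIn-punchOut y≢a

delete : ∀ {n} → Graph (suc n) → Fin (suc n) → Graph n
delete G y i j = G (punchIn y i) (punchIn y j)

module _ {n} {G : Graph (suc n)} {y : Fin (suc n)} where
  private
    punchIn-≢ : ∀ {a b} → a ≢ b → punchIn y a ≢ punchIn y b
    punchIn-≢ a≢b e = a≢b (punchIn-injective y _ _ e)

  delete-undirected : Undirected G → Undirected (delete G y)
  delete-undirected sym-G i j = sym-G _ _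

  delete-loopless : Loopless G → Loopless (delete G y)
  delete-loopless loopless i = loopless _

  pendant-delete : ∀ {a b} → Pendant G (punchIn y a) (punchIn y b) → Pendant (delete G y) a b
  pendant-delete (ab , only-b) = ab , λ z az → punchIn-injective y _ _ (only-b _ az)

  twins-delete : ∀ {a b} → Twins G (punchIn y a) (punchIn y b) → Twins (delete G y) a b
  twins-delete twins c c≢a c≢b = twins _ (punchIn-≢ c≢a) (punchIn-≢ c≢b)

  -- If y were the only neighbour of w, then y would be pendant on w or a twin of w (any
  -- other twin of y would be a second neighbour of w), so {w, y} would be an isolated edge.
  delete-noIsolatedVertex : Undirected G → Loopless G → NoIsolatedVertex G → NoIsolatedEdge G →
    Removable G y → NoIsolatedVertex (delete G y)
  delete-noIsolatedVertex sym-G loopless noIsolated noIsolatedEdge (q , y≢q , kind) w′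
    with any? (λ a → (G (punchIn y w′) a ≟ᵇ true) ×-dec ¬? (a ≟ y))
  ... | yes (a , wa , a≢y) with punchIn-preimage y a (≢-sym a≢y)
  ...   | a′ , refl = a′ , wa
  delete-noIsolatedVertex sym-G loopless noIsolated noIsolatedEdge (q , y≢q , kind) w′
      | no no-other = ⊥-elim (isolated-edge kind)
    where
    w = punchIn y w′
    only-y : ∀ z → G w z ≡ true → z ≡ y
    only-y z wz with z ≟ y
    ... | yes z≡y = z≡y
    ... | no z≢y  = ⊥-elim (no-other (z , wz , z≢y))
    wy : G w y ≡ true
    wy = let (b , wb) = noIsolated w in subst (λ c → G w c ≡ true) (only-y b wb) wb
    yw : G y w ≡ true
    yw = trans (sym-G y w) wy
    isolated-edge : Pendant G y q ⊎ Twins G y q → ⊥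
    isolated-edge (inj₁ (_ , only-q)) =
      noIsolatedEdge w y (wy , only-y) (yw , λ z yz → trans (only-q z yz) (sym (only-q w yw)))
    isolated-edge (inj₂ twins) with q ≟ w
    ... | yes refl = noIsolatedEdge w y (wy , only-y) (yw , only-w)
      where
      only-w : ∀ a → G y a ≡ true → a ≡ w
      only-w a ya with a ≟ w
      ... | yes a≡w = a≡w
      ... | no a≢w = ⊥-elim (adjacent⇒≢ loopless ya (sym (only-y a (trans (sym (twins a a≢y a≢w)) ya))))
        where
        a≢y : a ≢ y
        a≢y = ≢-sym (adjacent⇒≢ loopless ya)
    ... | no q≢w =
      y≢q (sym (only-y q (trans (sym-G w q) (trans (sym (twins w (punchInᵢ≢i y w′) (≢-sym q≢w))) yw))))

  module _ (sym-G : Undirected G) (z′ : Fin n) where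
    private
      z = punchIn y z′
      y≢z : y ≢ z
      y≢z = ≢-sym (punchInᵢ≢i y z′)

    isTrueTwin-delete : Removable G y → ¬ Twins G z y → IsTrueTwin G z → IsTrueTwin (delete G y) z′
    isTrueTwin-delete (q , y≢q , kind) ¬twins (p , z≢p , twins , zp , w , w≢p , zw)
      with any? (λ a → (G z a ≟ᵇ true) ×-dec (¬? (a ≟ p) ×-dec ¬? (a ≟ y)))
    ... | yes (w₂ , zw₂ , w₂≢p , w₂≢y)
      with punchIn-preimage y p (λ { refl → ¬twins twins }) | punchIn-preimage y w₂ (≢-sym w₂≢y)
    ...   | p′ , refl | w₂′ , refl =
      p′ , (λ e → z≢p (cong (punchIn y) e)) , twins-delete twins , zp ,
      w₂′ , (λ e → w₂≢p (cong (punchIn y) e)) , zw₂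
    isTrueTwin-delete (q , y≢q , kind) ¬twins (p , z≢p , twins , zp , w , w≢p , zw)
        | no no-other = ⊥-elim (y-not-removable kind)
      where
      p≢y : p ≢ y
      p≢y refl = ¬twins twins
      zy : G z y ≡ true
      zy with w ≟ y
      ... | yes refl = zw
      ... | no w≢y = ⊥-elim (no-other (w , zw , w≢p , w≢y))
      py : G p y ≡ true
      py = trans (sym (twins y y≢z (≢-sym p≢y))) zy
      y-not-removable : Pendant G y q ⊎ Twins G y q → ⊥
      y-not-removable (inj₁ (_ , only-q)) =
        z≢p (trans (only-q z (trans (sym-G y z) zy)) (sym (only-q p (trans (sym-G y p) py))))
      y-not-removable (inj₂ y-q-twins) with q ≟ p
      ... | yes refl = ¬twins z-y-twins
        where
        z-y-twins : Twins G z y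
        z-y-twins a a≢z a≢y with a ≟ q
        ... | yes refl = trans zp (sym (trans (sym-G y q) py))
        ... | no a≢q = trans (twins a a≢z a≢q) (sym (y-q-twins a a≢y a≢q))
      ... | no q≢p with q ≟ z
      ...   | yes refl = ¬twins (twins-sym {G = G} y-q-twins)
      ...   | no q≢z = no-other (q , zq , q≢p , ≢-sym y≢q)
        where
        zq : G z q ≡ true
        zq = trans (sym-G z q) (trans (sym (y-q-twins z (≢-sym y≢z) (≢-sym q≢z))) (trans (sym-G y z) zy))

    isTrueTwin-undelete : Loopless G → (r : Removable G z) → proj₁ r ≢ y →
      IsTrueTwin (delete G y) z′ → IsTrueTwin G z
    isTrueTwin-undelete loopless (v , z≢v , kind) v≢y z′-twin with punchIn-preimage y v (≢-sym v≢y)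
    ... | v′ , refl with kind
    ...   | inj₁ z-at-v = ⊥-elim (pendant⇒¬isTrueTwin (pendant-delete z-at-v) z′-twin)
    ...   | inj₂ twins with G z (punchIn y v′) in zv
    ...     | false = ⊥-elim (falseTwins⇒¬isTrueTwin (delete-undirected sym-G)
                        (λ e → z≢v (cong (punchIn y) e)) (twins-delete twins) zv z′-twin)
    ...     | true with z′-twin
    ...       | (p′ , _ , _ , zp′ , w′ , w′≢p′ , zw′) with w′ ≟ v′
    ...         | yes refl = punchIn y v′ , z≢v , twins , zv , punchIn y p′ , punchIn-≢ (≢-sym w′≢p′) , zp′
    ...         | no w′≢v′ = punchIn y v′ , z≢v , twins , zv , punchIn y w′ , punchIn-≢ w′≢v′ , zw′

    private
      partner-≢y : Removable G y → (r : Removable G z) → ¬ Twins G z y → proj₁ r ≢ y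
      partner-≢y y-removable (_ , _ , kind) ¬twins =
        partner-≢ sym-G y-removable (punchInᵢ≢i y z′) ¬twins kind

    removable-delete : Removable G y → Removable G z → ¬ Twins G z y → Removable (delete G y) z′
    removable-delete y-removable z-removable@(v , z≢v , kind) ¬twins
      with punchIn-preimage y v (≢-sym (partner-≢y y-removable z-removable ¬twins))
    ... | v′ , refl with kind
    ...   | inj₁ z-at-v = v′ , (λ e → z≢v (cong (punchIn y) e)) , inj₁ (pendant-delete z-at-v)
    ...   | inj₂ twins  = v′ , (λ e → z≢v (cong (punchIn y) e)) , inj₂ (twins-delete twins)

    isTrueTwin-delete-⇔ : Loopless G → Removable G y → Removable G z → ¬ Twins G z y →
      IsTrueTwin (delete G y) z′ ⇔ IsTrueTwin G z
    isTrueTwin-delete-⇔ loopless y-removable z-removable ¬twins =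
      mk⇔ (isTrueTwin-undelete loopless z-removable (partner-≢y y-removable z-removable ¬twins))
          (isTrueTwin-delete y-removable ¬twins)

record Extension {n} (H : Graph n) (G : Graph (suc n)) (y : Fin (suc n)) : Set where
  field
    op       : Op n
    allowed  : Allowed H op
    π        : Permutation (suc n) (suc n)
    iso      : apply H op ≅⟨ π ⟩ G
    π-zero   : π ⟨$⟩ʳ zero ≡ y
    reflects : Reflects (IsTrueTwin G y) (addsTrueTwin op)

module _ {n} {H : Graph n} {G : Graph (suc n)} {y : Fin (suc n)} {φ : Permutation n n}
         (sym-G : Undirected G) (loopless : Loopless G) (noIsolated : NoIsolatedVertex G)
         (H≅G-y : H ≅⟨ φ ⟩ delete G y) where
  private
    f = φ ⟨$⟩ʳ_
    g = φ ⟨$⟩ˡ_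
    π = insert zero y φ

    π-suc : ∀ k → π ⟨$⟩ʳ suc k ≡ punchIn y (f k)
    π-suc = insert-punchIn zero y φ

    extension-by : ∀ op → Allowed H op → (∀ j → newAdj H op j ≡ G y (punchIn y (f j))) →
      Reflects (IsTrueTwin G y) (addsTrueTwin op) → Extension H G y
    extension-by op allowed new-row reflects = record
      { op = op ; allowed = allowed ; π = π ; iso = isoBy adjacency ; π-zero = refl ; reflects = reflects }
      where
      adjacency : ∀ i j → apply H op i j ≡ G (π ⟨$⟩ʳ i) (π ⟨$⟩ʳ j)
      adjacency zero    zero    = sym (loopless y)
      adjacency zero    (suc j) = trans (new-row j) (cong (G y) (sym (π-suc j)))
      adjacency (suc i) zero    = trans (new-row i) (trans (sym-G _ _) (cong (λ c → G c y) (sym (π-suc i))))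
      adjacency (suc i) (suc j) = trans (same-adjacency H≅G-y i j) (sym (cong₂ G (π-suc i) (π-suc j)))

  module _ {v : Fin (suc n)} (y≢v : y ≢ v) where
    private
      a = g (punchOut y≢v)

      a↦v : punchIn y (f a) ≡ v
      a↦v = trans (cong (punchIn y) (inverseʳ φ)) (punchIn-punchOut y≢v)

      ≢a↦≢v : ∀ j → j ≢ a → punchIn y (f j) ≢ v
      ≢a↦≢v j j≢a e = j≢a (trans (sym (inverseˡ φ))
        (cong g (punchIn-injective y _ _ (trans e (sym (punchIn-punchOut y≢v))))))

      H-row-a : ∀ j → H a j ≡ G v (punchIn y (f j))
      H-row-a j = trans (same-adjacency H≅G-y a j) (cong (λ c → G c (punchIn y (f j))) a↦v)

      twins-row : Twins G y v → ∀ j → j ≢ a → H a j ≡ G y (punchIn y (f j))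
      twins-row twins j j≢a = trans (H-row-a j) (sym (twins _ (punchInᵢ≢i y (f j)) (≢a↦≢v j j≢a)))

      a-nonIsolated : Twins G y v → ∀ w → w ≢ v → G y w ≡ true → NonIsolated H a
      a-nonIsolated twins w w≢v yw with punchIn-preimage y w (adjacent⇒≢ loopless yw)
      ... | w′ , refl = g w′ , trans (H-row-a (g w′))
        (trans (cong (λ c → G v (punchIn y c)) (inverseʳ φ)) (trans (sym (twins _ (punchInᵢ≢i y w′) w≢v)) yw))

    extension-pendant : Pendant G y v → Extension H G y
    extension-pendant (yv , only-v) =
      extension-by (pendant a) tt new-row (ofⁿ (pendant⇒¬isTrueTwin (yv , only-v)))
      where
      new-row : ∀ j → ⌊ j ≟ a ⌋ ≡ G y (punchIn y (f j))
      new-row j with j ≟ a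
      ... | yes refl = sym (trans (cong (G y) a↦v) yv)
      ... | no j≢a = sym (¬-not (λ yj → ≢a↦≢v j j≢a (only-v _ yj)))

    extension-trueTwin : Twins G y v → G y v ≡ true → ∀ w → w ≢ v → G y w ≡ true → Extension H G y
    extension-trueTwin twins yv w w≢v yw =
      extension-by (trueTwin a) (a-nonIsolated twins w w≢v yw) new-row
        (ofʸ (v , y≢v , twins , yv , w , w≢v , yw))
      where
      new-row : ∀ j → (⌊ j ≟ a ⌋ ∨ H a j) ≡ G y (punchIn y (f j))
      new-row j with j ≟ a
      ... | yes refl = sym (trans (cong (G y) a↦v) yv)
      ... | no j≢a = twins-row twins j j≢a

    extension-falseTwin : Twins G y v → G y v ≡ false → Extension H G y
    extension-falseTwin twins yv =
      extension-by (falseTwin a) (a-nonIsolated twins w w≢v yw) new-row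
        (ofⁿ (falseTwins⇒¬isTrueTwin sym-G y≢v twins yv))
      where
      w = proj₁ (noIsolated y)
      yw = proj₂ (noIsolated y)
      w≢v : w ≢ v
      w≢v refl = true≢false (trans (sym yw) yv)
      new-row : ∀ j → H a j ≡ G y (punchIn y (f j))
      new-row j with j ≟ a
      ... | yes refl =
        trans (H-row-a a) (trans (cong (G v) a↦v) (trans (loopless v) (sym (trans (cong (G y) a↦v) yv))))
      ... | no j≢a = twins-row twins j j≢a

  extension : Removable G y → Extension H G y
  extension y-removable with removalKind G y y-removable
  ... | viaPendant y-at-v                  = extension-pendant (adjacent⇒≢ loopless (proj₁ y-at-v)) y-at-v
  ... | viaTrueTwin y≢v twins yv w w≢v yw  = extension-trueTwin y≢v twins yv w w≢v yw
  ... | viaFalseTwin y≢v twins yv          = extension-falseTwin y≢v twins yv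


delete-≅ : ∀ {n m} {K : Graph (suc n)} {G : Graph (suc m)} {τ : Permutation (suc n) (suc m)} a →
  K ≅⟨ τ ⟩ G → delete K a ≅⟨ remove a τ ⟩ delete G (τ ⟨$⟩ʳ a)
delete-≅ {G = G} {τ} a K≅G = isoBy λ i j →
  trans (same-adjacency K≅G (punchIn a i) (punchIn a j))
        (cong₂ G (punchIn-permute τ a i) (punchIn-permute τ a j))

delete-≅-at : ∀ {n m} {K : Graph (suc n)} {G : Graph (suc m)} {τ : Permutation (suc n) (suc m)} {a y} →
  K ≅⟨ τ ⟩ G → τ ⟨$⟩ʳ a ≡ y → delete K a ≅⟨ remove a τ ⟩ delete G y
delete-≅-at {a = a} K≅G refl = delete-≅ a K≅G

twins? : ∀ {n} (G : Graph n) a b → Dec (Twins G a b)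
twins? G a b = all? (λ z → ¬? (z ≟ a) →-dec (¬? (z ≟ b) →-dec (G a z ≟ᵇ G b z)))

twins-Fin2 : ∀ (G : Graph 2) → Twins G zero (suc zero)
twins-Fin2 G zero       z≢0 _   = ⊥-elim (z≢0 refl)
twins-Fin2 G (suc zero) _   z≢1 = ⊥-elim (z≢1 refl)

record Reordering {m} (s : OpSeq (suc m)) (x : Fin (suc m)) : Set where
  field
    seq    : OpSeq (suc m)
    valid  : Valid seq
    τ      : Permutation (suc m) (suc m)
    iso    : build seq ≅⟨ τ ⟩ build s
    τ-zero : τ ⟨$⟩ʳ zero ≡ x
    count  : trueTwinCount seq ≡ trueTwinCount s

reordering-twins : ∀ {m} (s : OpSeq (suc m)) → Valid s → ∀ {x} → Twins (build s) zero x → Reordering s x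
reordering-twins s valid {x} twins = record
  { seq = s ; valid = valid ; τ = transpose zero x
  ; iso = twins⇒transpose-≅ (build-undirected s) (build-loopless s) twins
  ; τ-zero = refl ; count = refl }

trueTwinCount-swap : ∀ {n} (s₁ : OpSeq n) (s₀ : OpSeq (suc n)) op₁ op a b →
  trueTwinBit a ≡ trueTwinBit op → trueTwinBit b ≡ trueTwinBit op₁ →
  trueTwinCount (s₁ ▷ op₁) ≡ trueTwinCount s₀ →
  trueTwinCount ((s₁ ▷ a) ▷ b) ≡ trueTwinCount (s₀ ▷ op)
trueTwinCount-swap s₁ s₀ op₁ op a b a≈op b≈op₁ count₁ = begin
  trueTwinCount ((s₁ ▷ a) ▷ b)
    ≡⟨ trans (trueTwinCount-▷ (s₁ ▷ a) b) (cong (trueTwinBit b +_) (trueTwinCount-▷ s₁ a)) ⟩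
  trueTwinBit b + (trueTwinBit a + trueTwinCount s₁)
    ≡⟨ cong₂ (λ u v → u + (v + trueTwinCount s₁)) b≈op₁ a≈op ⟩
  trueTwinBit op₁ + (trueTwinBit op + trueTwinCount s₁)
    ≡⟨ x∙yz≈y∙xz (trueTwinBit op₁) (trueTwinBit op) _ ⟩
  trueTwinBit op + (trueTwinBit op₁ + trueTwinCount s₁)
    ≡⟨ cong (trueTwinBit op +_) (trans (sym (trueTwinCount-▷ s₁ op₁)) count₁) ⟩
  trueTwinBit op + trueTwinCount s₀
    ≡⟨ sym (trueTwinCount-▷ s₀ op) ⟩
  trueTwinCount (s₀ ▷ op) ∎
  where open ≡-Reasoning

reorder-step : ∀ {k} (s₀ : OpSeq (suc (suc k))) op → Valid (s₀ ▷ op) → ∀ {x₀} →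
  Removable (build (s₀ ▷ op)) (suc x₀) → ¬ Twins (build (s₀ ▷ op)) (suc x₀) zero →
  Reordering s₀ x₀ → Reordering (s₀ ▷ op) (suc x₀)
reorder-step s₀ op valid@(valid₀ , allowed) {x₀} x-removable ¬twins
  record { seq = s₁ ▷ op₁ ; valid = valid₁ , allowed₁ ; τ = τ ; iso = iso ; τ-zero = τ-zero ; count = count }
  = record { seq = (s₁ ▷ A.op) ▷ B.op ; valid = (valid₁ , A.allowed) , B.allowed
           ; τ = B.π ; iso = B.iso ; τ-zero = B.π-zero
           ; count = trueTwinCount-swap s₁ s₀ op₁ op A.op B.op A≈op B≈op₁ count }
  where
  G = build (s₀ ▷ op)
  x = suc x₀
  sym-G = build-undirected (s₀ ▷ op)
  loopless-G = build-loopless (s₀ ▷ op)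
  noIsolated-G = build-noIsolatedVertex (s₀ ▷ op) valid
  zero-removable = removable-newVertex op
  ¬twins′ : ¬ Twins G zero x
  ¬twins′ twins = ¬twins (twins-sym {G = G} twins)

  extension-A : Extension (build s₁) (delete G x) zero
  extension-A = extension
    (delete-undirected {G = G} {y = x} sym-G) (delete-loopless {G = G} {y = x} loopless-G)
    (delete-noIsolatedVertex sym-G loopless-G noIsolated-G (build-noIsolatedEdge _ valid) x-removable)
    (delete-≅-at iso τ-zero) (removable-delete sym-G zero x-removable zero-removable ¬twins′)
  module A = Extension extension-A

  extension-B : Extension (build (s₁ ▷ A.op)) G x
  extension-B = extension sym-G loopless-G noIsolated-G A.iso x-removable
  module B = Extension extension-B

  A≈op : trueTwinBit A.op ≡ trueTwinBit op
  A≈op = trueTwinBit-≡ A.reflects (build-reflects s₀ op allowed)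
    (isTrueTwin-delete-⇔ sym-G zero loopless-G x-removable zero-removable ¬twins′)
  B≈op₁ : trueTwinBit B.op ≡ trueTwinBit op₁
  B≈op₁ = trueTwinBit-≡ B.reflects (build-reflects s₁ op₁ allowed₁)
    (⇔-sym (isTrueTwin-≅-⇔ iso τ-zero) ⇔-∘
     ⇔-sym (isTrueTwin-delete-⇔ sym-G x₀ loopless-G zero-removable x-removable ¬twins))

reorder : ∀ {k} (s : OpSeq (suc (suc k))) → Valid s → ∀ x → Removable (build s) x → Reordering s x
reorder s valid zero _ = reordering-twins s valid (λ _ _ _ → refl)
reorder {zero} s valid (suc zero) _ = reordering-twins s valid (twins-Fin2 (build s))
reorder {suc k} (s₀ ▷ op) valid (suc x₀) x-removable with twins? (build (s₀ ▷ op)) zero (suc x₀)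
... | yes twins = reordering-twins (s₀ ▷ op) valid twins
... | no ¬twins = reorder-step s₀ op valid x-removable ¬twins′
      (reorder s₀ (proj₁ valid) x₀
        (removable-delete (build-undirected (s₀ ▷ op)) x₀ (removable-newVertex op) x-removable ¬twins′))
  where
  ¬twins′ : ¬ Twins (build (s₀ ▷ op)) (suc x₀) zero
  ¬twins′ twins = ¬twins (twins-sym {G = build (s₀ ▷ op)} twins)

trueTwinCount-≅ : ∀ {k} (s s′ : OpSeq k) → Valid s → Valid s′ → ∀ {π} → build s ≅⟨ π ⟩ build s′ →
  trueTwinCount s ≡ trueTwinCount s′
trueTwinCount-≅ start start _ _ _ = refl
trueTwinCount-≅ start (() ▷ _) _ _ _
trueTwinCount-≅ (() ▷ _) start _ _ _
trueTwinCount-≅ {suc (suc k)} s@(_ ▷ _) (s₀′ ▷ op′) valid (valid₀′ , allowed′) {π} s≅s′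
  with reorder s valid (flip π ⟨$⟩ʳ zero) (removable-≅ (≅-sym s≅s′) (removable-newVertex op′))
... | record { seq = s₀ ▷ op ; valid = valid₀ , allowed ; τ = τ ; iso = iso ; τ-zero = τ-zero ; count = count } =
  begin
    trueTwinCount s                      ≡⟨ sym count ⟩
    trueTwinCount (s₀ ▷ op)              ≡⟨ trueTwinCount-▷ s₀ op ⟩
    trueTwinBit op + trueTwinCount s₀    ≡⟨ cong₂ _+_ op≈op′ rest ⟩
    trueTwinBit op′ + trueTwinCount s₀′  ≡⟨ sym (trueTwinCount-▷ s₀′ op′) ⟩
    trueTwinCount (s₀′ ▷ op′)            ∎
  where
  open ≡-Reasoning
  ρ-iso : build (s₀ ▷ op) ≅⟨ τ ∘ₚ π ⟩ build (s₀′ ▷ op′)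
  ρ-iso = ≅-trans iso s≅s′
  ρ-zero : (τ ∘ₚ π) ⟨$⟩ʳ zero ≡ zero
  ρ-zero = trans (cong (π ⟨$⟩ʳ_) τ-zero) (inverseʳ π)
  op≈op′ : trueTwinBit op ≡ trueTwinBit op′
  op≈op′ = trueTwinBit-≡ (build-reflects s₀ op allowed) (build-reflects s₀′ op′ allowed′)
    (isTrueTwin-≅-⇔ ρ-iso ρ-zero)
  rest : trueTwinCount s₀ ≡ trueTwinCount s₀′
  rest = trueTwinCount-≅ s₀ s₀′ valid₀ valid₀′ (delete-≅-at ρ-iso ρ-zero)

corollary4p24 : ∀ {n} (G : Graph n) → DistanceHereditary G →
    (c₁ c₂ : ConstructionSequence G) → csTrueTwins {G = G} c₁ ≡ csTrueTwins {G = G} c₂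
corollary4p24 G _ (_ , s₁ , valid₁ , σ₁ , iso₁) (_ , s₂ , valid₂ , σ₂ , iso₂)
  with ↔⇒≡ σ₁ | ↔⇒≡ σ₂
... | refl | refl = trueTwinCount-≅ s₁ s₂ valid₁ valid₂ (≅-trans s₁≅G (≅-sym s₂≅G))
  where
  s₁≅G : build s₁ ≅⟨ σ₁ ⟩ G
  s₁≅G = isoBy iso₁
  s₂≅G : build s₂ ≅⟨ σ₂ ⟩ G
  s₂≅G = isoBy iso₂
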